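{- Consider the variation of the temporal graph discovery game in which the Discoverer does not learn the static edge set. Let $n,T_{\max}\in\mathbb{N}^+$, $k\in[n]$, $m\in[\binom{n}{2}-n]$ and $\delta\in[T_{\max}]$. Then there is an Adversary such that any algorithm winning this game variation on graphs with $n$ nodes (and $m$ edges) must take at least $\lfloor nT_{\max}/(2\delta k)\rfloor$ rounds. This Adversary picks a graph with at most two $\delta$-edge connected components.
   Context: A simple temporal graph $\mathcal{G}=(V,E,\lambda)$ with lifetime $T_{\max}$ has a finite undirected static graph $(V,E)$ and labeling $\lambda:E\to[T_{\max}]=\{1,\dots,T_{\max}\}$. $\delta$-edge connected components: relate two edges if they share an endpoint and their labels differ by at most $\delta$; the equivalence classes of the reflexive-transitive closure are the $\delta$-edge connected components. Infection model with parameter $\delta$: all nodes start susceptible; a seed infection $(v,t)$ makes $v$ infected at time $t$; otherwise a susceptible node $u$ becomes infected at time $t$ iff some node $w$ infectious at time $t$ has an edge $uw$ with $\lambda(uw)=t$ (if several, exactly one infects $u$); a node infected at time $t$ is infectious at times $t+1,\dots,t+\delta$ and resistant afterwards. An infection log is the set of triples $(u,w,s)$ ($u$ infected $w$ at time $s$; seeds as $(u,u,s)$), consistent with a seed set if some chain with these seeds produces it. TGD game, unknown-static-graph variation, with parameters $T_{\max},\delta,k,n$: the Discoverer learns only the node set $V$ ($|V|=n$); each round it submits at most $k$ seed infections and the Adversary answers with a consistent infection log; to end, the Discoverer submits a temporal graph (edges and labels) and the Adversary responds with a temporal graph consistent with all logs; the Adversary wins if they differ, otherwise the Discoverer wins.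 $[x]=\{1,\dots,x\}$. -}

module Defs where

open import Data.Nat using (ℕ; zero; suc; _+_; _*_; _≤_; _<_; _<ᵇ_)
open import Data.Nat.DivMod using (_/_)
open import Data.Fin using (Fin; toℕ)
open import Data.Bool using (if_then_else_; _∧_)
open import Data.Maybe using (Maybe; just; nothing; is-just)
open import Data.Nat.ListAction using (sum)
open import Data.List using (List; []; _∷_; length; map; cartesianProduct; allFin)
open import Data.List.Membership.Propositional using (_∈_; _∉_)
open import Data.List.Relation.Unary.All using (All)
open import Data.Product using (Σ; ∃; _×_; _,_; proj₁; proj₂)
open import Data.Sum using (_⊎_)
open import Data.Empty using (⊥)
open import Relation.Binary.PropositionalEquality using (_≡_)
open import Relation.Binary.Construct.Closure.ReflexiveTransitive using (Star)

-- Temporal graphs on the node set Fin n with lifetime T.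
-- The labelling is a symmetric partial function on pairs of nodes:
-- lab u v ≡ just t  iff  uv ∈ E and λ(uv) = t.

Labelling : ℕ → Set
Labelling n = Fin n → Fin n → Maybe ℕ

record TGraph (n T : ℕ) : Set where
  field
    lab    : Labelling n
    irrefl : ∀ u → lab u u ≡ nothing
    symm   : ∀ u v → lab u v ≡ lab v u
    range  : ∀ u v t → lab u v ≡ just t → 1 ≤ t × t ≤ T
open TGraph public

edgeCount : ∀ {n} → Labelling n → ℕ
edgeCount {n} l =
  sum (map (λ p → if (toℕ (proj₁ p) <ᵇ toℕ (proj₂ p)) ∧ is-just (l (proj₁ p) (proj₂ p))
                  then 1 else 0)
           (cartesianProduct (allFin n) (allFin n)))

-- δ-edge connected components. An edge is given by an (ordered) pair of
-- its endpoints; (u,v) and (v,u) denote the same edge (and are related).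

IsEdge : ∀ {n} → Labelling n → Fin n × Fin n → Set
IsEdge l (u , v) = ∃ λ t → l u v ≡ just t

ShareEndpoint : ∀ {n} → Fin n × Fin n → Fin n × Fin n → Set
ShareEndpoint (u , v) (u' , v') = u ≡ u' ⊎ u ≡ v' ⊎ v ≡ u' ⊎ v ≡ v'

δAdj : ∀ {n} → ℕ → Labelling n → Fin n × Fin n → Fin n × Fin n → Set
δAdj δ l (u , v) (u' , v') =
  Σ ℕ λ t → Σ ℕ λ t' → l u v ≡ just t × l u' v' ≡ just t'
    × ShareEndpoint (u , v) (u' , v') × t ≤ t' + δ × t' ≤ t + δ

-- reflexive-transitive closure (δAdj is symmetric, so this is the
-- equivalence whose classes are the δ-edge connected components)
δConn : ∀ {n} → ℕ → Labelling n → Fin n × Fin n → Fin n × Fin n → Set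
δConn δ l = Star (δAdj δ l)

AtMostTwoComponents : ∀ {n} → ℕ → Labelling n → Set
AtMostTwoComponents δ l = ∀ e₁ e₂ e₃ → IsEdge l e₁ → IsEdge l e₂ → IsEdge l e₃ →
  δConn δ l e₁ e₂ ⊎ δConn δ l e₁ e₃ ⊎ δConn δ l e₂ e₃

Seeds : ℕ → Set
Seeds n = List (Fin n × ℕ)

-- An infection log: every node is infected at most once, so the set of
-- triples (w,u,s) ("w infected u at time s", seeds as (u,u,s)) is given
-- by  ℓ u ≡ just (w , s).
InfLog : ℕ → Set
InfLog n = Fin n → Maybe (Fin n × ℕ)

Infectious : ∀ {n} → ℕ → InfLog n → Fin n → ℕ → Set
Infectious {n} δ ℓ w t = Σ (Fin n) λ x → Σ ℕ λ s → ℓ w ≡ just (x , s) × s < t × t ≤ s + δ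

Trigger : ∀ {n} → ℕ → Labelling n → Seeds n → InfLog n → Fin n → ℕ → Set
Trigger δ l S ℓ u t = (u , t) ∈ S ⊎ ∃ λ w → l u w ≡ just t × Infectious δ ℓ w t

-- ℓ is the infection log of a run of the model on l with seeds S:
-- each recorded infection is justified (a seed has priority over an
-- infection by a neighbour), and every node is infected at the first
-- time something would infect it (and never if nothing ever would).
ConsistentLog : ∀ {n} → ℕ → Labelling n → Seeds n → InfLog n → Set
ConsistentLog δ l S ℓ = ∀ u →
  (∀ w t → ℓ u ≡ just (w , t) →
       (w ≡ u × (u , t) ∈ S)
     ⊎ ((u , t) ∉ S × l u w ≡ just t × Infectious δ ℓ w t))
  × (∀ t → Trigger δ l S ℓ u t → Σ (Fin _) λ w → Σ ℕ λ t₀ → ℓ u ≡ just (w , t₀) × t₀ ≤ t)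

-- a history: the rounds played so far (most recent first), each a query
-- together with the Adversary's infection log
History : ℕ → Set
History n = List (Seeds n × InfLog n)

data Move (n k : ℕ) : Set where
  query : (q : Seeds n) → length q ≤ k → Move n k
  guess : Labelling n → Move n k

-- a (deterministic) Discoverer algorithm: it only knows V = Fin n and
-- the history
Discoverer : ℕ → ℕ → Set
Discoverer n k = History n → Move n k

record Adversary (n T : ℕ) : Set where
  field
    answer : History n → Seeds n → InfLog n
    reveal : History n → Labelling n → TGraph n T
open Adversary public

data Generated {n T : ℕ} (k : ℕ) (A : Adversary n T) : History n → Set where
  start : Generated k A []
  step  : ∀ {h} (q : Seeds n) → length q ≤ k → Generated k A h →
          Generated k A ((q , answer A h q) ∷ h)

LegalAdversary : ∀ {n T} → ℕ → ℕ → ℕ → Adversary n T → Set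
LegalAdversary {n} {T} k δ m A = ∀ h → Generated k A h → ∀ (g : Labelling n) →
  edgeCount (lab (reveal A h g)) ≡ m
  × AtMostTwoComponents δ (lab (reveal A h g))
  × All (λ r → ConsistentLog δ (lab (reveal A h g)) (proj₁ r) (proj₂ r)) h

SameLabelling : ∀ {n} → Labelling n → Labelling n → Set
SameLabelling l l' = ∀ u v → l u v ≡ l' u v

winsFrom : ∀ {n k T} → Discoverer n k → Adversary n T → ℕ → History n → Move n k → Set
winsFrom D A r h (guess g) = SameLabelling g (lab (reveal A h g))
winsFrom D A zero h (query q _) = ⊥
winsFrom D A (suc r) h (query q _) =
  let h' = (q , answer A h q) ∷ h in winsFrom D A r h' (D h')

WinsWithin : ∀ {n k T} → Discoverer n k → Adversary n T → ℕ → Set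
WinsWithin D A r = winsFrom D A r [] (D [])

-- ⌊ n T / (2 δ k) ⌋ (only used with δ, k ≥ 1)
roundBound : ℕ → ℕ → ℕ → ℕ → ℕ
roundBound n T (suc d) (suc k) = (n * T) / (2 * suc d * suc k)
roundBound n T _ _ = 0

{-# OPTIONS --safe #-}
module Submission where

-- The Adversary hides one edge of the Hamiltonian cycle 0 – 1 – ⋯ – (n − 1) – 0. Its candidate
-- graphs consist of a fixed connected background of m − 1 non-cycle edges, all labelled T_max
-- (one δ-edge component), plus the i-th cycle edge with some label t (the second component).
-- While some candidate is still possible it answers every query with the infection log of the
-- background alone. Background infections happen only at time T_max, so this log stays consistent
-- with candidate (i , t) unless a seed (x , s) has x on the i-th cycle edge and s < t ≤ s + δ.
-- A seed therefore rules out at most 2δ of the n · T_max candidates; after r rounds of k seeds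
-- with (r + 1) · 2δk ≤ n · T_max two candidates survive, and the Adversary reveals one whose
-- graph differs from the Discoverer's guess.

open import Defs
open import Data.Nat using (ℕ; _≤_; _∸_)
open import Data.Nat.Combinatorics using (_C_)
open import Data.Product using (Σ; _×_)
open import Data.List using ([])

open import Data.Nat using (zero; suc; NonZero; _+_; _*_; _⊓_; _<_; z≤n; s≤s; _≟_; _<?_; _≤?_; _<ᵇ_)
open import Data.Nat using (_≤′_; ≤′-refl; ≤′-step)
open import Data.Nat.Properties
open import Data.Nat.Combinatorics using (nC1≡n; nCk+nC[k+1]≡[n+1]C[k+1])
open import Data.Nat.Tactic.RingSolver using (solve-∀)
open import Data.Nat.DivMod using (_/_; m/n*n≤m)
open import Data.Nat.ListAction using (sum)
open import Data.Nat.ListAction.Properties using (sum-++)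
open import Data.Fin using (Fin; toℕ; fromℕ<; #_)
open import Data.Fin.Properties using (toℕ-fromℕ<; toℕ-injective)
open import Data.Fin.Properties using (any?) renaming (_≟_ to _≟ᶠ_; all? to allᶠ?)
open import Data.List using (List; _∷_; _++_; map; concat; length; cartesianProduct; allFin; tabulate)
open import Data.List.Properties using (map-tabulate; map-++; map-∘; map-cong; length-++)
open import Data.List.Membership.Propositional using (_∈_; _∉_)
open import Data.List.Membership.Propositional.Properties using (∈-map⁺)
open import Data.List.Relation.Unary.All using (All; all?; _∷_) renaming (lookup to lookupᴬ; [] to []ᴬ)
open import Data.List.Relation.Unary.All.Properties using (++⁻ˡ; ++⁻ʳ)
open import Data.List.Extrema.Nat using (max; ⊥≤max; xs≤max)
import Data.List.Membership.DecPropositional as DecMembership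
open import Data.Maybe using (Maybe; just; nothing)
open import Data.Maybe.Properties using () renaming (≡-dec to ≡-decᵐ)
open import Data.Product using (∃; _,_; proj₁; proj₂; map₂)
open import Data.Product.Properties using () renaming (≡-dec to ≡-decˣ)
open import Data.Sum using (_⊎_; inj₁; inj₂; swap)
open import Data.Empty using (⊥; ⊥-elim)
open import Function using (_∘_; Equivalence)
open import Data.Bool using (true; false; if_then_else_; _∧_)
open import Data.Bool.Properties using (∧-zeroʳ; T-≡; ¬-not)
open import Data.Maybe using (is-just)
open import Relation.Nullary using (Dec; yes; no; ¬_; ¬?)
open import Relation.Nullary.Decidable using (_×-dec_; _⊎-dec_; decidable-stable)
open import Relation.Binary.PropositionalEquality
open import Relation.Binary.Construct.Closure.ReflexiveTransitive using (ε; _◅_; _◅◅_; reverse)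
open import Algebra.Properties.CommutativeSemigroup +-commutativeSemigroup using (interchange)

-- Arithmetic and finite sums

𝟙 : ∀ {P : Set} → Dec P → ℕ
𝟙 (yes _) = 1
𝟙 (no _)  = 0

𝟙-yes : ∀ {P : Set} (d : Dec P) → P → 𝟙 d ≡ 1
𝟙-yes (yes _) _ = refl
𝟙-yes (no ¬p) p = ⊥-elim (¬p p)

𝟙-no : ∀ {P : Set} (d : Dec P) → ¬ P → 𝟙 d ≡ 0
𝟙-no (yes p) ¬p = ⊥-elim (¬p p)
𝟙-no (no _)  _  = refl

𝟙-mono : ∀ {P Q : Set} (p : Dec P) (q : Dec Q) → (P → Q) → 𝟙 p ≤ 𝟙 q
𝟙-mono (yes a) q f = ≤-reflexive (sym (𝟙-yes q (f a)))
𝟙-mono (no _)  q f = z≤n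

𝟙-⊎ : ∀ {P Q R : Set} (p : Dec P) (q : Dec Q) (r : Dec R) → (P → Q ⊎ R) → 𝟙 p ≤ 𝟙 q + 𝟙 r
𝟙-⊎ (no _)  q r f = z≤n
𝟙-⊎ (yes x) q r f with f x
... | inj₁ y = subst (λ c → 1 ≤ c + 𝟙 r) (sym (𝟙-yes q y)) (s≤s z≤n)
... | inj₂ z = subst (λ c → 1 ≤ 𝟙 q + c) (sym (𝟙-yes r z)) (m≤n+m 1 (𝟙 q))

𝟙-× : ∀ {P Q : Set} (p : Dec P) (q : Dec Q) → 𝟙 (p ×-dec q) ≡ 𝟙 p * 𝟙 q
𝟙-× (yes _) (yes _) = refl
𝟙-× (yes _) (no _)  = refl
𝟙-× (no _)  (yes _) = refl
𝟙-× (no _)  (no _)  = refl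

∑< : ℕ → (ℕ → ℕ) → ℕ
∑< zero    f = 0
∑< (suc n) f = ∑< n f + f n

syntax ∑< n (λ i → e) = ∑[ i < n ] e

∑-cong : ∀ n {f g : ℕ → ℕ} → (∀ i → i < n → f i ≡ g i) → ∑< n f ≡ ∑< n g
∑-cong zero    eq = refl
∑-cong (suc n) eq = cong₂ _+_ (∑-cong n (λ i i<n → eq i (m≤n⇒m≤1+n i<n))) (eq n ≤-refl)

∑-mono-≤ : ∀ n {f g : ℕ → ℕ} → (∀ i → i < n → f i ≤ g i) → ∑< n f ≤ ∑< n g
∑-mono-≤ zero    le = z≤n
∑-mono-≤ (suc n) le = +-mono-≤ (∑-mono-≤ n (λ i i<n → le i (m≤n⇒m≤1+n i<n))) (le n ≤-refl)

∑-mono-bound : ∀ {m m'} (f : ℕ → ℕ) → m ≤ m' → ∑< m f ≤ ∑< m' f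
∑-mono-bound f m≤m' = go (≤⇒≤′ m≤m')
  where
  go : ∀ {m m'} → m ≤′ m' → ∑< m f ≤ ∑< m' f
  go ≤′-refl           = ≤-refl
  go (≤′-step m≤m')    = ≤-trans (go m≤m') (m≤m+n _ _)

∑-const : ∀ n c → ∑[ _ < n ] c ≡ n * c
∑-const zero    c = refl
∑-const (suc n) c = trans (cong (_+ c) (∑-const n c)) (+-comm (n * c) c)

∑-zero : ∀ n {f : ℕ → ℕ} → (∀ i → i < n → f i ≡ 0) → ∑< n f ≡ 0
∑-zero n eq = trans (∑-cong n eq) (trans (∑-const n 0) (*-zeroʳ n))

∑-+ : ∀ n (f g : ℕ → ℕ) → ∑[ i < n ] (f i + g i) ≡ ∑< n f + ∑< n g
∑-+ zero    f g = refl
∑-+ (suc n) f g = trans (cong (_+ (f n + g n)) (∑-+ n f g)) (interchange (∑< n f) (∑< n g) (f n) (g n))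

∑-*ˡ : ∀ n c (f : ℕ → ℕ) → ∑[ i < n ] (c * f i) ≡ c * ∑< n f
∑-*ˡ zero    c f = sym (*-zeroʳ c)
∑-*ˡ (suc n) c f = trans (cong (_+ c * f n) (∑-*ˡ n c f)) (sym (*-distribˡ-+ c (∑< n f) (f n)))

∑-*ʳ : ∀ n c (f : ℕ → ℕ) → ∑[ i < n ] (f i * c) ≡ ∑< n f * c
∑-*ʳ n c f = trans (∑-cong n (λ i _ → *-comm (f i) c)) (trans (∑-*ˡ n c f) (*-comm c (∑< n f)))

∑-swap : ∀ n m (h : ℕ → ℕ → ℕ) → ∑[ a < n ] ∑[ b < m ] h a b ≡ ∑[ b < m ] ∑[ a < n ] h a b
∑-swap zero    m h = sym (∑-zero m (λ _ _ → refl))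
∑-swap (suc n) m h = trans (cong (_+ ∑< m (h n)) (∑-swap n m h)) (sym (∑-+ m (λ b → ∑[ a < n ] h a b) (h n)))

∑∑-product : ∀ n m (f g : ℕ → ℕ) → ∑[ a < n ] ∑[ b < m ] (f a * g b) ≡ ∑< n f * ∑< m g
∑∑-product n m f g = trans (∑-cong n (λ a _ → ∑-*ˡ m (f a) g)) (∑-*ʳ n (∑< m g) f)

∑-suc : ∀ n (f : ℕ → ℕ) → ∑< (suc n) f ≡ f 0 + ∑[ i < n ] f (suc i)
∑-suc zero    f = +-comm 0 (f 0)
∑-suc (suc n) f = trans (cong (_+ f (suc n)) (∑-suc n f)) (+-assoc (f 0) _ (f (suc n)))

∑-point≤1 : ∀ n x → ∑[ a < n ] 𝟙 (a ≟ x) ≤ 1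
∑-point≤1 zero    x = z≤n
∑-point≤1 (suc n) x with n ≟ x
... | no _     = ≤-trans (≤-reflexive (+-identityʳ _)) (∑-point≤1 n x)
... | yes refl = ≤-reflexive (cong (_+ 1) (∑-zero n (λ a a<n → 𝟙-no (a ≟ n) (<⇒≢ a<n))))

∑-point : ∀ n x → x < n → ∑[ a < n ] 𝟙 (a ≟ x) ≡ 1
∑-point (suc n) x x<1+n with n ≟ x
... | yes refl = cong (_+ 1) (∑-zero n (λ a a<n → 𝟙-no (a ≟ n) (<⇒≢ a<n)))
... | no n≢x   = trans (+-identityʳ _) (∑-point n x (≤∧≢⇒< (≤-pred x<1+n) (≢-sym n≢x)))

∑∑-atMostOne : ∀ N M {P : ℕ → ℕ → Set} (P? : ∀ i j → Dec (P i j)) →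
  (∀ {i j i' j'} → i < N → j < M → i' < N → j' < M → P i j → P i' j' → i ≡ i' × j ≡ j') →
  ∑[ i < N ] ∑[ j < M ] 𝟙 (P? i j) ≤ 1
∑∑-atMostOne N M P? unique with anyUpTo? (λ i → anyUpTo? (P? i) M) N
... | no none = ≤-trans (≤-reflexive (∑-zero N (λ i i<N → ∑-zero M (λ j j<M →
                  𝟙-no (P? i j) (λ p → none (i , i<N , j , j<M , p)))))) z≤n
... | yes (i₀ , i₀<N , j₀ , j₀<M , p₀) = begin
  ∑[ i < N ] ∑[ j < M ] 𝟙 (P? i j)
    ≤⟨ ∑-mono-≤ N (λ i i<N → ∑-mono-≤ M (λ j j<M →
         𝟙-mono (P? i j) ((i ≟ i₀) ×-dec (j ≟ j₀)) (λ p → unique i<N j<M i₀<N j₀<M p p₀))) ⟩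
  ∑[ i < N ] ∑[ j < M ] 𝟙 ((i ≟ i₀) ×-dec (j ≟ j₀))
    ≡⟨ ∑-cong N (λ i _ → ∑-cong M (λ j _ → 𝟙-× (i ≟ i₀) (j ≟ j₀))) ⟩
  ∑[ i < N ] ∑[ j < M ] (𝟙 (i ≟ i₀) * 𝟙 (j ≟ j₀))
    ≡⟨ ∑∑-product N M (λ i → 𝟙 (i ≟ i₀)) (λ j → 𝟙 (j ≟ j₀)) ⟩
  ∑[ i < N ] 𝟙 (i ≟ i₀) * ∑[ j < M ] 𝟙 (j ≟ j₀)
    ≤⟨ *-mono-≤ (∑-point≤1 N i₀) (∑-point≤1 M j₀) ⟩
  1 ∎
  where open ≤-Reasoning

InInterval : ℕ → ℕ → ℕ → Set
InInterval s d b = s ≤ b × b < s + d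

inInterval? : ∀ s d b → Dec (InInterval s d b)
inInterval? s d b = (s ≤? b) ×-dec (b <? s + d)

∑-interval : ∀ N s d → ∑[ b < N ] 𝟙 (inInterval? s d b) ≡ (N ⊓ (s + d)) ∸ s
∑-interval zero    s d = sym (0∸n≡0 s)
∑-interval (suc N) s d with inInterval? s d N
... | yes (s≤N , N<s+d)
  rewrite ∑-interval N s d | m≤n⇒m⊓n≡m (<⇒≤ N<s+d) | m≤n⇒m⊓n≡m N<s+d
  = trans (sym (+-∸-comm 1 s≤N)) (cong (_∸ s) (+-comm N 1))
... | no ∉ rewrite +-identityʳ (∑[ b < N ] 𝟙 (inInterval? s d b)) | ∑-interval N s d with N <? s
...   | yes N<s = trans (m≤n⇒m∸n≡0 (≤-trans (m⊓n≤m N (s + d)) (<⇒≤ N<s)))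
                        (sym (m≤n⇒m∸n≡0 (≤-trans (m⊓n≤m (suc N) (s + d)) N<s)))
...   | no N≮s with N <? s + d
...     | yes N<s+d = ⊥-elim (∉ (≮⇒≥ N≮s , N<s+d))
...     | no N≮s+d  =
  cong (_∸ s) (trans (m≥n⇒m⊓n≡n (≮⇒≥ N≮s+d)) (sym (m≥n⇒m⊓n≡n (m≤n⇒m≤1+n (≮⇒≥ N≮s+d)))))

∑-interval-inside : ∀ N s d → s + d ≤ N → ∑[ b < N ] 𝟙 (inInterval? s d b) ≡ d
∑-interval-inside N s d s+d≤N =
  trans (∑-interval N s d) (trans (cong (_∸ s) (m≥n⇒m⊓n≡n s+d≤N)) (m+n∸m≡n s d))

∑-interval≤ : ∀ N s d → ∑[ b < N ] 𝟙 (inInterval? s d b) ≤ d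
∑-interval≤ N s d = begin
  ∑[ b < N ] 𝟙 (inInterval? s d b) ≡⟨ ∑-interval N s d ⟩
  (N ⊓ (s + d)) ∸ s                 ≤⟨ ∸-monoˡ-≤ s (m⊓n≤n N (s + d)) ⟩
  s + d ∸ s                         ≡⟨ m+n∸m≡n s d ⟩
  d                                 ∎
  where open ≤-Reasoning

⊓-+-split : ∀ k x y → k ⊓ x + (k ∸ x) ⊓ y ≡ k ⊓ (x + y)
⊓-+-split zero    x       y = cong (_⊓ y) (0∸n≡0 x)
⊓-+-split (suc k) zero    y = refl
⊓-+-split (suc k) (suc x) y = cong suc (⊓-+-split k x y)

suc-C2 : ∀ N → suc N C 2 ≡ N + N C 2
suc-C2 N = begin
  suc N C 2      ≡⟨ sym (nCk+nC[k+1]≡[n+1]C[k+1] N 1) ⟩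
  N C 1 + N C 2  ≡⟨ cong (_+ N C 2) (nC1≡n N) ⟩
  N + N C 2      ∎
  where open ≡-Reasoning

∑-pred : ∀ N → ∑[ c < suc N ] (c ∸ 1) ≡ N C 2
∑-pred zero    = refl
∑-pred (suc N) = trans (cong (_+ N) (∑-pred N)) (trans (+-comm (N C 2) N) (sym (suc-C2 N)))

<⇒<ᵇ≡true : ∀ {a b} → a < b → (a <ᵇ b) ≡ true
<⇒<ᵇ≡true a<b = Equivalence.to T-≡ (<⇒<ᵇ a<b)

≮⇒<ᵇ≡false : ∀ {a b} → ¬ a < b → (a <ᵇ b) ≡ false
≮⇒<ᵇ≡false {a} {b} a≮b = ¬-not (a≮b ∘ <ᵇ⇒< a b ∘ Equivalence.from T-≡)

quotient-exceeded : ∀ x c .{{_ : NonZero c}} r → ¬ (x / c ≤ r) → suc r * c ≤ x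
quotient-exceeded x c r x/c≰r = ≤-trans (*-monoˡ-≤ c (≰⇒> x/c≰r)) (m/n*n≤m x c)

sum-tabulate : ∀ n (g : ℕ → ℕ) → sum (tabulate {n = n} (g ∘ toℕ)) ≡ ∑< n g
sum-tabulate zero    g = refl
sum-tabulate (suc n) g = trans (cong (g 0 +_) (sum-tabulate n (g ∘ suc))) (sym (∑-suc n g))

sum-allFin : ∀ n (g : ℕ → ℕ) → sum (map (g ∘ toℕ) (allFin n)) ≡ ∑< n g
sum-allFin n g = trans (cong sum (map-tabulate {n = n} (λ i → i) (g ∘ toℕ))) (sum-tabulate n g)

sum-cartesianProduct : ∀ {A B : Set} (xs : List A) (ys : List B) (F : A × B → ℕ) →
  sum (map F (cartesianProduct xs ys)) ≡ sum (map (λ x → sum (map (λ y → F (x , y)) ys)) xs)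
sum-cartesianProduct []       ys F = refl
sum-cartesianProduct (x ∷ xs) ys F = begin
  sum (map F (map (x ,_) ys ++ cartesianProduct xs ys))
    ≡⟨ cong sum (map-++ F (map (x ,_) ys) (cartesianProduct xs ys)) ⟩
  sum (map F (map (x ,_) ys) ++ map F (cartesianProduct xs ys))
    ≡⟨ sum-++ (map F (map (x ,_) ys)) _ ⟩
  sum (map F (map (x ,_) ys)) + sum (map F (cartesianProduct xs ys))
    ≡⟨ cong₂ _+_ (cong sum (sym (map-∘ ys))) (sum-cartesianProduct xs ys F) ⟩
  sum (map (λ y → F (x , y)) ys) + sum (map (λ x → sum (map (λ y → F (x , y)) ys)) xs) ∎
  where open ≡-Reasoning

sum-allFin² : ∀ n (h : ℕ → ℕ → ℕ) →
  sum (map (λ p → h (toℕ (proj₁ p)) (toℕ (proj₂ p))) (cartesianProduct (allFin n) (allFin n)))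
  ≡ ∑[ a < n ] ∑[ b < n ] h a b
sum-allFin² n h = trans (sum-cartesianProduct (allFin n) (allFin n) _)
  (trans (cong sum (map-cong (λ u → sum-allFin n (h (toℕ u))) (allFin n)))
         (sum-allFin n (λ a → ∑[ b < n ] h a b)))

-- Temporal graphs and infection logs

sameLabelling? : ∀ {n} (l l' : Labelling n) → Dec (SameLabelling l l')
sameLabelling? l l' = allᶠ? (λ u → allᶠ? (λ v → ≡-decᵐ _≟_ (l u v) (l' u v)))

ShareEndpoint-sym : ∀ {n} (e e' : Fin n × Fin n) → ShareEndpoint e e' → ShareEndpoint e' e
ShareEndpoint-sym _ _ (inj₁ eq)                 = inj₁ (sym eq)
ShareEndpoint-sym _ _ (inj₂ (inj₁ eq))          = inj₂ (inj₂ (inj₁ (sym eq)))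
ShareEndpoint-sym _ _ (inj₂ (inj₂ (inj₁ eq)))   = inj₂ (inj₁ (sym eq))
ShareEndpoint-sym _ _ (inj₂ (inj₂ (inj₂ eq)))   = inj₂ (inj₂ (inj₂ (sym eq)))

δAdj-sym : ∀ {n} δ (l : Labelling n) {e e'} → δAdj δ l e e' → δAdj δ l e' e
δAdj-sym δ l {e} {e'} (t , t' , le , le' , share , t≤t'+δ , t'≤t+δ) =
  t' , t , le' , le , ShareEndpoint-sym e e' share , t'≤t+δ , t≤t'+δ

δConn-sym : ∀ {n} δ (l : Labelling n) {e e'} → δConn δ l e e' → δConn δ l e' e
δConn-sym δ l = reverse (δAdj-sym δ l)

atMostTwoComponents-cover : ∀ {n} δ (l : Labelling n) (P Q : Fin n × Fin n → Set) →
  (∀ e → IsEdge l e → P e ⊎ Q e) →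
  (∀ e e' → P e → P e' → δConn δ l e e') → (∀ e e' → Q e → Q e' → δConn δ l e e') →
  AtMostTwoComponents δ l
atMostTwoComponents-cover δ l P Q cover connP connQ e₁ e₂ e₃ edge₁ edge₂ edge₃
  with cover e₁ edge₁ | cover e₂ edge₂ | cover e₃ edge₃
... | inj₁ p₁ | inj₁ p₂ | _       = inj₁ (connP e₁ e₂ p₁ p₂)
... | inj₂ q₁ | inj₂ q₂ | _       = inj₁ (connQ e₁ e₂ q₁ q₂)
... | inj₁ p₁ | inj₂ _  | inj₁ p₃ = inj₂ (inj₁ (connP e₁ e₃ p₁ p₃))
... | inj₂ q₁ | inj₁ _  | inj₂ q₃ = inj₂ (inj₁ (connQ e₁ e₃ q₁ q₃))
... | inj₁ _  | inj₂ q₂ | inj₂ q₃ = inj₂ (inj₂ (connQ e₂ e₃ q₂ q₃))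
... | inj₂ _  | inj₁ p₂ | inj₁ p₃ = inj₂ (inj₂ (connP e₂ e₃ p₂ p₃))

infectious? : ∀ {n} δ (ℓ : InfLog n) w t → Dec (Infectious δ ℓ w t)
infectious? δ ℓ w t with ℓ w
... | nothing = no λ ()
... | just (x , s) with s <? t | t ≤? s + δ
...   | yes s<t | yes t≤s+δ = yes (x , s , refl , s<t , t≤s+δ)
...   | no s≮t  | _         = no λ { (_ , _ , refl , s<t , _) → s≮t s<t }
...   | yes _   | no t≰s+δ  = no λ { (_ , _ , refl , _ , t≤s+δ) → t≰s+δ t≤s+δ }

module Simulation {n : ℕ} (δ : ℕ) (l : Labelling n) (S : Seeds n) where

  open DecMembership (≡-decˣ (_≟ᶠ_ {n}) _≟_) using (_∈?_)

  NeighbourTrigger : InfLog n → Fin n → ℕ → Set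
  NeighbourTrigger ℓ u t = ∃ λ w → l u w ≡ just t × Infectious δ ℓ w t

  neighbourTrigger? : ∀ ℓ u t → Dec (NeighbourTrigger ℓ u t)
  neighbourTrigger? ℓ u t = any? (λ w → ≡-decᵐ _≟_ (l u w) (just t) ×-dec infectious? δ ℓ w t)

  infectAt : ℕ → InfLog n → InfLog n
  infectAt t ℓ u with ℓ u
  ... | just x  = just x
  ... | nothing with (u , t) ∈? S
  ...   | yes _ = just (u , t)
  ...   | no _ with neighbourTrigger? ℓ u t
  ...     | yes (w , _) = just (w , t)
  ...     | no _        = nothing

  nothing-or-just : ∀ {A : Set} (m : Maybe A) → m ≡ nothing ⊎ ∃ λ x → m ≡ just x
  nothing-or-just nothing  = inj₁ refl
  nothing-or-just (just x) = inj₂ (x , refl)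

  logBefore : ℕ → InfLog n
  logBefore zero    _ = nothing
  logBefore (suc t)   = infectAt t (logBefore t)

  logBefore-keeps : ∀ t u {x} → logBefore t u ≡ just x → logBefore (suc t) u ≡ just x
  logBefore-keeps t u eq rewrite eq = refl

  logBefore-justified : ∀ t u {w s} → logBefore t u ≡ nothing → logBefore (suc t) u ≡ just (w , s) →
    s ≡ t × ((w ≡ u × (u , t) ∈ S) ⊎ ((u , t) ∉ S × l u w ≡ just t × Infectious δ (logBefore t) w t))
  logBefore-justified t u fresh infected rewrite fresh with (u , t) ∈? S
  ... | yes u∈S with refl ← infected = refl , inj₁ (refl , u∈S)
  ... | no u∉S with neighbourTrigger? (logBefore t) u t
  ...   | yes (w , luw , infectious) with refl ← infected = refl , inj₂ (u∉S , luw , infectious)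

  logBefore-fresh-fires : ∀ t u → logBefore t u ≡ nothing → (u , t) ∈ S ⊎ NeighbourTrigger (logBefore t) u t →
    ∃ λ x → logBefore (suc t) u ≡ just x
  logBefore-fresh-fires t u fresh trigger rewrite fresh with (u , t) ∈? S
  ... | yes _ = _ , refl
  ... | no u∉S with neighbourTrigger? (logBefore t) u t | trigger
  ...   | yes _ | _            = _ , refl
  ...   | no _  | inj₁ u∈S     = ⊥-elim (u∉S u∈S)
  ...   | no ¬t | inj₂ trigger = ⊥-elim (¬t trigger)

  logBefore-mono : ∀ {t t'} u {x} → t ≤ t' → logBefore t u ≡ just x → logBefore t' u ≡ just x
  logBefore-mono u t≤t' = go (≤⇒≤′ t≤t')
    where
    go : ∀ {t t' x} → t ≤′ t' → logBefore t u ≡ just x → logBefore t' u ≡ just x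
    go ≤′-refl        eq = eq
    go {t' = suc t'} (≤′-step t≤t') eq = logBefore-keeps t' u (go t≤t' eq)

  logBefore-origin : ∀ t u {w s} → logBefore t u ≡ just (w , s) →
    s < t × logBefore s u ≡ nothing × logBefore (suc s) u ≡ just (w , s)
  logBefore-origin (suc t) u eq with nothing-or-just (logBefore t u)
  ... | inj₂ (_ , earlier)
    with s<t , rest ← logBefore-origin t u (trans earlier (trans (sym (logBefore-keeps t u earlier)) eq))
    = m≤n⇒m≤1+n s<t , rest
  ... | inj₁ fresh with refl , _ ← logBefore-justified t u fresh eq = ≤-refl , fresh , eq

  logBefore-fires : ∀ t u → (u , t) ∈ S ⊎ NeighbourTrigger (logBefore t) u t →
    ∃ λ x → logBefore (suc t) u ≡ just x
  logBefore-fires t u trigger with nothing-or-just (logBefore t u)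
  ... | inj₂ (x , earlier) = x , logBefore-keeps t u earlier
  ... | inj₁ fresh         = logBefore-fresh-fires t u fresh trigger

  infectious-mono : ∀ {s t} w {τ} → s ≤ t → Infectious δ (logBefore s) w τ → Infectious δ (logBefore t) w τ
  infectious-mono w s≤t (x , s , eq , rest) = x , s , logBefore-mono w s≤t eq , rest

  infectious-early : ∀ N w {τ} → Infectious δ (logBefore N) w τ → Infectious δ (logBefore τ) w τ
  infectious-early N w (x , s , eq , s<τ , τ≤s+δ) =
    x , s , logBefore-mono w s<τ (proj₂ (proj₂ (logBefore-origin N w eq))) , s<τ , τ≤s+δ

  logBefore-consistent : ∀ N → (∀ u w t → l u w ≡ just t → t ≤ N) → (∀ u t → (u , t) ∈ S → t ≤ N) →
    ConsistentLog δ l S (logBefore (suc N))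
  logBefore-consistent N label≤N seed≤N u = justified , earliest
    where
    justified : ∀ w t → logBefore (suc N) u ≡ just (w , t) →
      (w ≡ u × (u , t) ∈ S) ⊎ ((u , t) ∉ S × l u w ≡ just t × Infectious δ (logBefore (suc N)) w t)
    justified w t eq with t<1+N , fresh , infected ← logBefore-origin (suc N) u eq
      with logBefore-justified t u fresh infected
    ... | _ , inj₁ seeded                        = inj₁ seeded
    ... | _ , inj₂ (u∉S , luw , infectious) = inj₂ (u∉S , luw , infectious-mono w (<⇒≤ t<1+N) infectious)
    infectedBy : ∀ t → t ≤ N → ∃ (λ x → logBefore (suc t) u ≡ just x) →
      Σ (Fin n) λ w → Σ ℕ λ t₀ → logBefore (suc N) u ≡ just (w , t₀) × t₀ ≤ t
    infectedBy t t≤N ((w , t₀) , eq) =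
      w , t₀ , logBefore-mono u (s≤s t≤N) eq , ≤-pred (proj₁ (logBefore-origin (suc t) u eq))
    earliest : ∀ t → Trigger δ l S (logBefore (suc N)) u t →
      Σ (Fin n) λ w → Σ ℕ λ t₀ → logBefore (suc N) u ≡ just (w , t₀) × t₀ ≤ t
    earliest t (inj₁ u∈S) = infectedBy t (seed≤N u t u∈S) (logBefore-fires t u (inj₁ u∈S))
    earliest t (inj₂ (w , luw , infectious)) = infectedBy t (label≤N u w t luw)
      (logBefore-fires t u (inj₂ (w , luw , infectious-early (suc N) w infectious)))

consistentLog-extend : ∀ {n} δ (l l' : Labelling n) S ℓ → ConsistentLog δ l S ℓ →
  (∀ u w t → l u w ≡ just t → l' u w ≡ just t) →
  (∀ u w t → l' u w ≡ just t → l u w ≡ just t ⊎ ¬ Infectious δ ℓ w t) →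
  ConsistentLog δ l' S ℓ
consistentLog-extend {n} δ l l' S ℓ consistent l⊆l' l'⊆l u = justified , earliest
  where
  justified : ∀ w t → ℓ u ≡ just (w , t) →
    (w ≡ u × (u , t) ∈ S) ⊎ ((u , t) ∉ S × l' u w ≡ just t × Infectious δ ℓ w t)
  justified w t eq with proj₁ (consistent u) w t eq
  ... | inj₁ seeded                   = inj₁ seeded
  ... | inj₂ (u∉S , luw , infectious) = inj₂ (u∉S , l⊆l' u w t luw , infectious)
  earliest : ∀ t → Trigger δ l' S ℓ u t → Σ (Fin n) λ w → Σ ℕ λ t₀ → ℓ u ≡ just (w , t₀) × t₀ ≤ t
  earliest t (inj₁ u∈S) = proj₂ (consistent u) t (inj₁ u∈S)
  earliest t (inj₂ (w , l'uw , infectious)) with l'⊆l u w t l'uw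
  ... | inj₁ luw         = proj₂ (consistent u) t (inj₂ (w , luw , infectious))
  ... | inj₂ ¬infectious = ⊥-elim (¬infectious infectious)

-- The candidate graphs

-- Writing n = 4 + n' makes the vertices 0, …, 3 available as literals of Fin n.
module HiddenCycleEdge (n' K T : ℕ) where

  n : ℕ
  n = 4 + n'

  isLast? : ∀ u → Dec (suc u ≡ n)
  isLast? u = suc u ≟ n

  cycleLo cycleHi : ℕ → ℕ
  cycleLo i with isLast? i
  ... | yes _ = 0
  ... | no _  = i
  cycleHi i with isLast? i
  ... | yes _ = i
  ... | no _  = suc i

  -- Column b consists of the non-cycle pairs (a , b) with a < b, that is first b ≤ a < first b + capacity b.
  -- The background takes the first K such pairs column by column, quota b of them from column b.
  first capacity : ℕ → ℕ
  first b with isLast? b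
  ... | yes _ = 1
  ... | no _  = 0
  capacity b with isLast? b
  ... | yes _ = b ∸ 2
  ... | no _  = b ∸ 1

  filledBefore : ℕ → ℕ
  filledBefore b = ∑< b capacity

  quota : ℕ → ℕ
  quota b = (K ∸ filledBefore b) ⊓ capacity b

  InBackground : ℕ → ℕ → Set
  InBackground a b = InInterval (first b) (quota b) a

  inBackground? : ∀ a b → Dec (InBackground a b)
  inBackground? a b = inInterval? (first b) (quota b) a

  first-last : ∀ b → suc b ≡ n → first b ≡ 1
  first-last b last with isLast? b
  ... | yes _    = refl
  ... | no ¬last = ⊥-elim (¬last last)

  capacity-last : capacity (3 + n') ≡ 1 + n'
  capacity-last with isLast? (3 + n')
  ... | yes _    = refl
  ... | no ¬last = ⊥-elim (¬last refl)

  cycleLo<cycleHi : ∀ i → cycleLo i < cycleHi i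
  cycleLo<cycleHi i with isLast? i
  ... | yes refl = s≤s z≤n
  ... | no _     = ≤-refl

  cycleHi<n : ∀ i → i < n → cycleHi i < n
  cycleHi<n i i<n with isLast? i
  ... | yes _     = i<n
  ... | no ¬last  = ≤∧≢⇒< i<n ¬last

  cycleLo<n : ∀ i → i < n → cycleLo i < n
  cycleLo<n i i<n = <-trans (cycleLo<cycleHi i) (cycleHi<n i i<n)

  column-end : ∀ b → first b + capacity b ≤ b ∸ 1
  column-end b with isLast? b
  ... | yes refl = ≤-refl
  ... | no _     = ≤-refl

  background-end : ∀ b → first b + quota b ≤ b ∸ 1
  background-end b = ≤-trans (+-monoʳ-≤ (first b) (m⊓n≤n _ _)) (column-end b)

  inBackground⇒< : ∀ a b → InBackground a b → a < b
  inBackground⇒< a b (_ , a<end) = ≤-trans a<end (≤-trans (background-end b) (m∸n≤m b 1))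

  ¬inBackground-cycle : ∀ i → ¬ InBackground (cycleLo i) (cycleHi i)
  ¬inBackground-cycle i with isLast? i
  ... | yes refl = λ (first≤0 , _) → 1+n≰n (subst (_≤ 0) (first-last (3 + n') refl) first≤0)
  ... | no _     = λ (_ , i<end) → <-irrefl refl (≤-trans i<end (background-end (suc i)))

  Oriented : ℕ → ℕ → ℕ → Set
  Oriented i a b = a ≡ cycleLo i × b ≡ cycleHi i

  oriented? : ∀ i a b → Dec (Oriented i a b)
  oriented? i a b = (a ≟ cycleLo i) ×-dec (b ≟ cycleHi i)

  OnCycleEdge : ℕ → ℕ → ℕ → Set
  OnCycleEdge i a b = Oriented i a b ⊎ Oriented i b a

  onCycleEdge? : ∀ i a b → Dec (OnCycleEdge i a b)
  onCycleEdge? i a b = oriented? i a b ⊎-dec oriented? i b a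

  Background : ℕ → ℕ → Set
  Background a b = InBackground a b ⊎ InBackground b a

  background? : ∀ a b → Dec (Background a b)
  background? a b = inBackground? a b ⊎-dec inBackground? b a

  oriented⇒< : ∀ i {a b} → Oriented i a b → a < b
  oriented⇒< i (refl , refl) = cycleLo<cycleHi i

  inBackground-off-cycle : ∀ i a b → InBackground a b → ¬ OnCycleEdge i a b
  inBackground-off-cycle i a b inB (inj₁ (refl , refl)) = ¬inBackground-cycle i inB
  inBackground-off-cycle i a b inB (inj₂ o)             = <-asym (inBackground⇒< a b inB) (oriented⇒< i o)

  background-off-cycle : ∀ i a b → Background a b → ¬ OnCycleEdge i a b
  background-off-cycle i a b (inj₁ inB) = inBackground-off-cycle i a b inB
  background-off-cycle i a b (inj₂ inB) = inBackground-off-cycle i b a inB ∘ swap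

  background : ℕ → ℕ → Maybe ℕ
  background a b with background? a b
  ... | yes _ = just T
  ... | no _  = nothing

  hidden : ℕ → ℕ → ℕ → ℕ → Maybe ℕ
  hidden i t a b with onCycleEdge? i a b
  ... | yes _ = just t
  ... | no _  = background a b

  background-just : ∀ a b {x} → background a b ≡ just x → Background a b × x ≡ T
  background-just a b eq with background? a b
  ... | yes inB with refl ← eq = inB , refl

  background-yes : ∀ a b → Background a b → background a b ≡ just T
  background-yes a b bg with background? a b
  ... | yes _  = refl
  ... | no ¬bg = ⊥-elim (¬bg bg)

  background⇒hidden : ∀ {i t a b x} → background a b ≡ just x → hidden i t a b ≡ just x
  background⇒hidden {i} {t} {a} {b} eq with onCycleEdge? i a b
  ... | yes onC = ⊥-elim (background-off-cycle i a b (proj₁ (background-just a b eq)) onC)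
  ... | no _    = eq

  hidden⇒background : ∀ {i t a b x} → hidden i t a b ≡ just x →
    background a b ≡ just x ⊎ (OnCycleEdge i a b × x ≡ t)
  hidden⇒background {i} {t} {a} {b} eq with onCycleEdge? i a b
  ... | yes onC with refl ← eq = inj₂ (onC , refl)
  ... | no _    = inj₁ eq

  hidden-on-cycle : ∀ {i t a b} → OnCycleEdge i a b → hidden i t a b ≡ just t
  hidden-on-cycle {i} {t} {a} {b} onC with onCycleEdge? i a b
  ... | yes _   = refl
  ... | no ¬onC = ⊥-elim (¬onC onC)

  hidden-edge : ∀ {i t a b x} → hidden i t a b ≡ just x → (OnCycleEdge i a b × x ≡ t) ⊎ (Background a b × x ≡ T)
  hidden-edge {a = a} {b} eq with hidden⇒background eq
  ... | inj₁ inB = inj₂ (background-just a b inB)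
  ... | inj₂ onC = inj₁ onC

  background-sym : ∀ a b → background a b ≡ background b a
  background-sym a b with background? a b | background? b a
  ... | yes _   | yes _   = refl
  ... | no _    | no _    = refl
  ... | yes inB | no ¬inB = ⊥-elim (¬inB (swap inB))
  ... | no ¬inB | yes inB = ⊥-elim (¬inB (swap inB))

  hidden-sym : ∀ i t a b → hidden i t a b ≡ hidden i t b a
  hidden-sym i t a b with onCycleEdge? i a b | onCycleEdge? i b a
  ... | yes _   | yes _   = refl
  ... | no _    | no _    = background-sym a b
  ... | yes onC | no ¬onC = ⊥-elim (¬onC (swap onC))
  ... | no ¬onC | yes onC = ⊥-elim (¬onC (swap onC))

  background-irrefl : ∀ a → background a a ≡ nothing
  background-irrefl a with background? a a
  ... | yes inB = ⊥-elim (<-irrefl refl (inBackground⇒< a a (reduce inB)))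
    where reduce : Background a a → InBackground a a
          reduce (inj₁ inB) = inB
          reduce (inj₂ inB) = inB
  ... | no _    = refl

  hidden-irrefl : ∀ i t a → hidden i t a a ≡ nothing
  hidden-irrefl i t a with onCycleEdge? i a a
  ... | yes (inj₁ o) = ⊥-elim (<-irrefl refl (oriented⇒< i o))
  ... | yes (inj₂ o) = ⊥-elim (<-irrefl refl (oriented⇒< i o))
  ... | no _         = background-irrefl a

  edge-indicator : ∀ i t a b →
    (if (a <ᵇ b) ∧ is-just (hidden i t a b) then 1 else 0) ≡ 𝟙 (oriented? i a b) + 𝟙 (inBackground? a b)
  edge-indicator i t a b with onCycleEdge? i a b
  ... | yes (inj₁ o)
    rewrite <⇒<ᵇ≡true (oriented⇒< i o) | 𝟙-yes (oriented? i a b) o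
          | 𝟙-no (inBackground? a b) (λ inB → inBackground-off-cycle i a b inB (inj₁ o)) = refl
  ... | yes (inj₂ o)
    rewrite ≮⇒<ᵇ≡false (<⇒≯ (oriented⇒< i o))
          | 𝟙-no (oriented? i a b) (λ o' → <-asym (oriented⇒< i o') (oriented⇒< i o))
          | 𝟙-no (inBackground? a b) (λ inB → inBackground-off-cycle i a b inB (inj₂ o)) = refl
  ... | no ¬onC with background? a b
  ...   | yes (inj₁ inB)
    rewrite <⇒<ᵇ≡true (inBackground⇒< a b inB) | 𝟙-no (oriented? i a b) (¬onC ∘ inj₁)
          | 𝟙-yes (inBackground? a b) inB = refl
  ...   | yes (inj₂ inB)
    rewrite ≮⇒<ᵇ≡false (<⇒≯ (inBackground⇒< b a inB)) | 𝟙-no (oriented? i a b) (¬onC ∘ inj₁)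
          | 𝟙-no (inBackground? a b) (<⇒≯ (inBackground⇒< b a inB) ∘ inBackground⇒< a b) = refl
  ...   | no ¬inB
    rewrite ∧-zeroʳ (a <ᵇ b) | 𝟙-no (oriented? i a b) (¬onC ∘ inj₁)
          | 𝟙-no (inBackground? a b) (¬inB ∘ inj₁) = refl

  cycle-count : ∀ i → i < n → ∑[ a < n ] ∑[ b < n ] 𝟙 (oriented? i a b) ≡ 1
  cycle-count i i<n = begin
    ∑[ a < n ] ∑[ b < n ] 𝟙 (oriented? i a b)
      ≡⟨ ∑-cong n (λ a _ → ∑-cong n (λ b _ → 𝟙-× (a ≟ cycleLo i) (b ≟ cycleHi i))) ⟩
    ∑[ a < n ] ∑[ b < n ] (𝟙 (a ≟ cycleLo i) * 𝟙 (b ≟ cycleHi i))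
      ≡⟨ ∑∑-product n n (λ a → 𝟙 (a ≟ cycleLo i)) (λ b → 𝟙 (b ≟ cycleHi i)) ⟩
    ∑[ a < n ] 𝟙 (a ≟ cycleLo i) * ∑[ b < n ] 𝟙 (b ≟ cycleHi i)
      ≡⟨ cong₂ _*_ (∑-point n (cycleLo i) (cycleLo<n i i<n)) (∑-point n (cycleHi i) (cycleHi<n i i<n)) ⟩
    1 ∎
    where open ≡-Reasoning

  ∑-quota : ∀ b → ∑< b quota ≡ K ⊓ filledBefore b
  ∑-quota zero    = sym (⊓-zeroʳ K)
  ∑-quota (suc b) = begin
    ∑< b quota + quota b                                ≡⟨ cong (_+ quota b) (∑-quota b) ⟩
    K ⊓ filledBefore b + (K ∸ filledBefore b) ⊓ capacity b ≡⟨ ⊓-+-split K (filledBefore b) (capacity b) ⟩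
    K ⊓ (filledBefore b + capacity b)                   ∎
    where open ≡-Reasoning

  background-count : ∑[ a < n ] ∑[ b < n ] 𝟙 (inBackground? a b) ≡ K ⊓ filledBefore n
  background-count = begin
    ∑[ a < n ] ∑[ b < n ] 𝟙 (inBackground? a b) ≡⟨ ∑-swap n n (λ a b → 𝟙 (inBackground? a b)) ⟩
    ∑[ b < n ] ∑[ a < n ] 𝟙 (inBackground? a b)
      ≡⟨ ∑-cong n (λ b b<n → ∑-interval-inside n (first b) (quota b) (end≤n b b<n)) ⟩
    ∑< n quota                                   ≡⟨ ∑-quota n ⟩
    K ⊓ filledBefore n                           ∎
    where
    open ≡-Reasoning
    end≤n : ∀ b → b < n → first b + quota b ≤ n
    end≤n b b<n = ≤-trans (background-end b) (≤-trans (m∸n≤m b 1) (<⇒≤ b<n))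

  capacity-inner : ∀ b → suc b ≢ n → capacity b ≡ b ∸ 1
  capacity-inner b ¬last with isLast? b
  ... | yes last = ⊥-elim (¬last last)
  ... | no _     = refl

  filledBefore-n : filledBefore n ≡ n C 2 ∸ n
  filledBefore-n = trans (sym (m+n∸n≡m (filledBefore n) n)) (cong (_∸ n) total)
    where
    open ≡-Reasoning
    inner : ∀ c → c < 3 + n' → capacity c ≡ c ∸ 1
    inner c c<last = capacity-inner c (λ last → <-irrefl (suc-injective last) c<last)
    rearrange : ∀ c m → c + (1 + m) + (4 + m) ≡ (3 + m) + ((2 + m) + c)
    rearrange = solve-∀
    total : filledBefore n + n ≡ n C 2
    total = begin
      ∑< (3 + n') capacity + capacity (3 + n') + n
        ≡⟨ cong₂ (λ x y → x + y + n) (∑-cong (3 + n') inner) capacity-last ⟩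
      ∑[ c < 3 + n' ] (c ∸ 1) + (1 + n') + (4 + n')  ≡⟨ cong (λ x → x + (1 + n') + (4 + n')) (∑-pred (2 + n')) ⟩
      (2 + n') C 2 + (1 + n') + (4 + n')             ≡⟨ rearrange ((2 + n') C 2) n' ⟩
      (3 + n') + ((2 + n') + (2 + n') C 2)           ≡⟨ cong ((3 + n') +_) (sym (suc-C2 (2 + n'))) ⟩
      (3 + n') + (3 + n') C 2                        ≡⟨ sym (suc-C2 (3 + n')) ⟩
      n C 2                                          ∎

  labelling : ℕ → ℕ → Labelling n
  labelling i t u v = hidden i t (toℕ u) (toℕ v)

  edgeCount-labelling : ∀ i t → i < n → K ≤ filledBefore n → edgeCount (labelling i t) ≡ suc K
  edgeCount-labelling i t i<n K≤filled = begin
    edgeCount (labelling i t)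
      ≡⟨ sum-allFin² n (λ a b → if (a <ᵇ b) ∧ is-just (hidden i t a b) then 1 else 0) ⟩
    ∑[ a < n ] ∑[ b < n ] (if (a <ᵇ b) ∧ is-just (hidden i t a b) then 1 else 0)
      ≡⟨ ∑-cong n (λ a _ → ∑-cong n (λ b _ → edge-indicator i t a b)) ⟩
    ∑[ a < n ] ∑[ b < n ] (𝟙 (oriented? i a b) + 𝟙 (inBackground? a b))
      ≡⟨ trans (∑-cong n (λ a _ → ∑-+ n _ _)) (∑-+ n _ _) ⟩
    ∑[ a < n ] ∑[ b < n ] 𝟙 (oriented? i a b) + ∑[ a < n ] ∑[ b < n ] 𝟙 (inBackground? a b)
      ≡⟨ cong₂ _+_ (cycle-count i i<n) (trans background-count (m≤n⇒m⊓n≡m K≤filled)) ⟩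
    suc K ∎
    where open ≡-Reasoning

  cycleEdge-injective : ∀ {i j} → Oriented j (cycleLo i) (cycleHi i) → i ≡ j
  cycleEdge-injective {i} {j} with isLast? i | isLast? j
  ... | yes refl | yes refl = λ _ → refl
  ... | no _     | no _     = proj₁
  ... | yes refl | no _     = λ { (refl , ()) }
  ... | no _     | yes refl = λ { (refl , ()) }

  labelling-injective : ∀ {i j t t'} → i < n → SameLabelling (labelling i t) (labelling j t') → i ≡ j × t ≡ t'
  labelling-injective {i} {j} {t} {t'} i<n same with hidden-edge {j} {t'} hidden-j
    where
    lo hi : Fin n
    lo = fromℕ< (cycleLo<n i i<n)
    hi = fromℕ< (cycleHi<n i i<n)
    hidden-j : hidden j t' (cycleLo i) (cycleHi i) ≡ just t
    hidden-j = begin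
      hidden j t' (cycleLo i) (cycleHi i) ≡⟨ cong₂ (hidden j t') (sym lo≡) (sym hi≡) ⟩
      hidden j t' (toℕ lo) (toℕ hi)      ≡⟨ sym (same lo hi) ⟩
      hidden i t (toℕ lo) (toℕ hi)       ≡⟨ cong₂ (hidden i t) lo≡ hi≡ ⟩
      hidden i t (cycleLo i) (cycleHi i) ≡⟨ hidden-on-cycle {i} (inj₁ (refl , refl)) ⟩
      just t                             ∎
      where
      open ≡-Reasoning
      lo≡ : toℕ lo ≡ cycleLo i
      lo≡ = toℕ-fromℕ< (cycleLo<n i i<n)
      hi≡ : toℕ hi ≡ cycleHi i
      hi≡ = toℕ-fromℕ< (cycleHi<n i i<n)
  ... | inj₁ (inj₁ o , t≡t') = cycleEdge-injective o , t≡t'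
  ... | inj₁ (inj₂ o , _)    = ⊥-elim (<-asym (cycleLo<cycleHi i) (oriented⇒< j o))
  ... | inj₂ (bg , _)        = ⊥-elim (background-off-cycle i (cycleLo i) (cycleHi i) bg (inj₁ (refl , refl)))

  first-inner : ∀ b → suc b ≢ n → first b ≡ 0
  first-inner b ¬last with isLast? b
  ... | yes last = ⊥-elim (¬last last)
  ... | no _     = refl

  quota-positive : ∀ a b → InBackground a b → 1 ≤ quota b
  quota-positive a b (first≤a , a<end) = +-cancelˡ-< (first b) 0 (quota b)
    (≤-<-trans (≤-reflexive (+-identityʳ (first b))) (≤-<-trans first≤a a<end))

  inBackground⇒2≤ : ∀ a b → InBackground a b → 2 ≤ b
  inBackground⇒2≤ a (suc (suc b)) _ = s≤s (s≤s z≤n)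
  inBackground⇒2≤ a 0 (_ , a<end) = ⊥-elim (n≮0 (≤-trans a<end (background-end 0)))
  inBackground⇒2≤ a 1 (_ , a<end) = ⊥-elim (n≮0 (≤-trans a<end (background-end 1)))

  quota-positive⇒filledBefore<K : ∀ b → 1 ≤ quota b → filledBefore b < K
  quota-positive⇒filledBefore<K b 1≤quota = m∸n≢0⇒n<m (≢-sym (<⇒≢ (≤-trans 1≤quota (m⊓n≤m _ _))))

  earlier-column-full : ∀ {b c} → 1 ≤ quota b → c < b → quota c ≡ capacity c
  earlier-column-full {b} {c} 1≤quota c<b = m≥n⇒m⊓n≡n (begin
    capacity c                            ≡⟨ sym (m+n∸m≡n (filledBefore c) (capacity c)) ⟩
    filledBefore (suc c) ∸ filledBefore c
      ≤⟨ ∸-monoˡ-≤ (filledBefore c) (≤-trans (∑-mono-bound capacity c<b) (<⇒≤ before<K)) ⟩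
    K ∸ filledBefore c                    ∎)
    where
    open ≤-Reasoning
    before<K : filledBefore b < K
    before<K = quota-positive⇒filledBefore<K b 1≤quota

  column-start : ∀ a b → suc b ≢ n → InBackground a b → InBackground 0 b
  column-start a b ¬last inB =
    subst (λ f → f ≤ 0 × 0 < f + quota b) (sym (first-inner b ¬last)) (z≤n , quota-positive a b inB)

  hub-inBackground : ∀ a b → InBackground a b → InBackground 0 2
  hub-inBackground a b inB with b ≟ 2
  ... | yes refl = column-start a 2 (λ ()) inB
  ... | no b≢2   = z≤n , subst (1 ≤_) (sym (earlier-column-full (quota-positive a b inB) 2<b)) ≤-refl
    where
    2<b : 2 < b
    2<b = ≤∧≢⇒< (inBackground⇒2≤ a b inB) (≢-sym b≢2)

  last-column-wide : K < filledBefore n → 1 ≤ quota (3 + n') → 1 ≤ n'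
  last-column-wide K<filled 1≤quota = ≤-pred (+-cancelˡ-< (filledBefore (3 + n')) 1 (suc n')
    (≤-<-trans (≤-reflexive (+-comm (filledBefore (3 + n')) 1)) (≤-<-trans before<K K<filled′)))
    where
    before<K : filledBefore (3 + n') < K
    before<K = quota-positive⇒filledBefore<K (3 + n') 1≤quota
    K<filled′ : K < filledBefore (3 + n') + suc n'
    K<filled′ = subst (λ c → K < filledBefore (3 + n') + c) capacity-last K<filled

  hidden-background : ∀ {i t} a b → Background a b → hidden i t a b ≡ just T
  hidden-background a b bg = background⇒hidden (background-yes a b bg)

  module Connected (δ i t : ℕ) (K<filled : K < filledBefore n) where

    BackgroundPair OnCyclePair : Fin n × Fin n → Set
    BackgroundPair (u , v) = Background (toℕ u) (toℕ v)
    OnCyclePair (u , v) = OnCycleEdge i (toℕ u) (toℕ v)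

    Chain : Fin n × Fin n → Fin n × Fin n → Set
    Chain = δConn δ (labelling i t)

    hub : Fin n × Fin n
    hub = # 0 , # 2

    background-adjacent : ∀ e e' → BackgroundPair e → BackgroundPair e' → ShareEndpoint e e' →
      δAdj δ (labelling i t) e e'
    background-adjacent (u , v) (u' , v') bg bg' share =
      T , T , hidden-background _ _ bg , hidden-background _ _ bg' , share , m≤m+n T δ , m≤m+n T δ

    inner-to-hub : ∀ u v → suc (toℕ v) ≢ n → InBackground (toℕ u) (toℕ v) → Chain (u , v) hub
    inner-to-hub u v ¬last inB =
      background-adjacent (u , v) (# 0 , v) (inj₁ inB) (inj₁ 0∈v) (inj₂ (inj₂ (inj₂ refl)))
      ◅ background-adjacent (# 0 , v) hub (inj₁ 0∈v) (inj₁ (hub-inBackground _ _ inB)) (inj₁ refl)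
      ◅ ε
      where
      0∈v : InBackground 0 (toℕ v)
      0∈v = column-start (toℕ u) (toℕ v) ¬last inB

    -- The last column avoids vertex 0; it is reached through column 3, which is full and, as the
    -- last column is nonempty only when n ≥ 5, not the last one.
    last-to-hub : ∀ u v → suc (toℕ v) ≡ n → InBackground (toℕ u) (toℕ v) → Chain (u , v) hub
    last-to-hub u v last inB =
      background-adjacent (u , v) (# 1 , v) (inj₁ inB) (inj₁ 1∈v) (inj₂ (inj₂ (inj₂ refl)))
      ◅ background-adjacent (# 1 , v) (# 1 , # 3) (inj₁ 1∈v) (inj₁ 1∈3) (inj₁ refl)
      ◅ inner-to-hub (# 1) (# 3) 3-inner 1∈3
      where
      1≤quota : 1 ≤ quota (toℕ v)
      1≤quota = quota-positive (toℕ u) (toℕ v) inB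
      wide : 1 ≤ n'
      wide = last-column-wide K<filled (subst (λ b → 1 ≤ quota b) (suc-injective last) 1≤quota)
      3-inner : suc 3 ≢ n
      3-inner 4≡n = 1+n≰n (subst (1 ≤_) (sym (cong (_∸ 4) 4≡n)) wide)
      3<v : 3 < toℕ v
      3<v = subst (3 <_) (sym (suc-injective last)) (+-monoʳ-< 3 wide)
      1∈v : InBackground 1 (toℕ v)
      1∈v = subst (λ f → f ≤ 1 × 1 < f + quota (toℕ v)) (sym (first-last (toℕ v) last)) (≤-refl , s≤s 1≤quota)
      quota3 : quota 3 ≡ 2
      quota3 = trans (earlier-column-full 1≤quota 3<v) (capacity-inner 3 3-inner)
      1∈3 : InBackground 1 3
      1∈3 = subst₂ (λ f q → f ≤ 1 × 1 < f + q) (sym (first-inner 3 3-inner)) (sym quota3) (z≤n , ≤-refl)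

    to-hub : ∀ e → BackgroundPair e → Chain e hub
    to-hub (u , v) (inj₁ inB) = column-to-hub (isLast? (toℕ v))
      where
      column-to-hub : Dec (suc (toℕ v) ≡ n) → Chain (u , v) hub
      column-to-hub (yes last) = last-to-hub u v last inB
      column-to-hub (no ¬last) = inner-to-hub u v ¬last inB
    to-hub (u , v) (inj₂ inB) =
      background-adjacent (u , v) (v , u) (inj₂ inB) (inj₁ inB) (inj₂ (inj₁ refl)) ◅ to-hub (v , u) (inj₁ inB)

    background-connected : ∀ e e' → BackgroundPair e → BackgroundPair e' → Chain e e'
    background-connected e e' bg bg' = to-hub e bg ◅◅ δConn-sym δ (labelling i t) (to-hub e' bg')

    cycle-connected : ∀ e e' → OnCyclePair e → OnCyclePair e' → Chain e e'
    cycle-connected (u , v) (u' , v') c c' =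
      (t , t , hidden-on-cycle c , hidden-on-cycle c' , share c c' , m≤m+n t δ , m≤m+n t δ) ◅ ε
      where
      share : OnCyclePair (u , v) → OnCyclePair (u' , v') → ShareEndpoint (u , v) (u' , v')
      share (inj₁ (x , _)) (inj₁ (x' , _)) = inj₁ (toℕ-injective (trans x (sym x')))
      share (inj₁ (x , _)) (inj₂ (x' , _)) = inj₂ (inj₁ (toℕ-injective (trans x (sym x'))))
      share (inj₂ (x , _)) (inj₁ (x' , _)) = inj₂ (inj₂ (inj₁ (toℕ-injective (trans x (sym x')))))
      share (inj₂ (x , _)) (inj₂ (x' , _)) = inj₂ (inj₂ (inj₂ (toℕ-injective (trans x (sym x')))))

    cycle-or-background : ∀ e → IsEdge (labelling i t) e → OnCyclePair e ⊎ BackgroundPair e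
    cycle-or-background (u , v) (_ , eq) with hidden-edge {i} {t} {toℕ u} {toℕ v} eq
    ... | inj₁ (onC , _) = inj₁ onC
    ... | inj₂ (bg , _)  = inj₂ bg

    atMostTwoComponents : AtMostTwoComponents δ (labelling i t)
    atMostTwoComponents = atMostTwoComponents-cover δ (labelling i t) OnCyclePair BackgroundPair
      cycle-or-background cycle-connected background-connected

  Endpoint : ℕ → ℕ → Set
  Endpoint i x = x ≡ cycleLo i ⊎ x ≡ cycleHi i

  endpoint? : ∀ i x → Dec (Endpoint i x)
  endpoint? i x = (x ≟ cycleLo i) ⊎-dec (x ≟ cycleHi i)

  cyclicPred : ℕ → ℕ
  cyclicPred zero    = 3 + n'
  cyclicPred (suc x) = x

  endpoint⇒ : ∀ i x → Endpoint i x → i ≡ x ⊎ i ≡ cyclicPred x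
  endpoint⇒ i x with isLast? i
  ... | yes refl = λ { (inj₁ refl) → inj₂ refl ; (inj₂ refl) → inj₁ refl }
  ... | no _     = λ { (inj₁ refl) → inj₁ refl ; (inj₂ refl) → inj₂ refl }

  endpoint-count : ∀ x → ∑[ i < n ] 𝟙 (endpoint? i x) ≤ 2
  endpoint-count x = begin
    ∑[ i < n ] 𝟙 (endpoint? i x)
      ≤⟨ ∑-mono-≤ n (λ i _ → 𝟙-⊎ (endpoint? i x) (i ≟ x) (i ≟ cyclicPred x) (endpoint⇒ i x)) ⟩
    ∑[ i < n ] (𝟙 (i ≟ x) + 𝟙 (i ≟ cyclicPred x))
      ≡⟨ ∑-+ n _ _ ⟩
    ∑[ i < n ] 𝟙 (i ≟ x) + ∑[ i < n ] 𝟙 (i ≟ cyclicPred x)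
      ≤⟨ +-mono-≤ (∑-point≤1 n x) (∑-point≤1 n (cyclicPred x)) ⟩
    2 ∎
    where open ≤-Reasoning

  -- The Adversary

  module Strategy (δ : ℕ) (1≤T : 1 ≤ T) (K<filled : K < filledBefore n) where

    -- The candidate with slot j hides its cycle edge under the label suc j.
    record Candidate : Set where
      constructor candidate
      field
        edge slot : ℕ
        edge<n    : edge < n
        slot<T    : slot < T
    open Candidate

    graph : Candidate → TGraph n T
    graph (candidate i j _ j<T) = record
      { lab    = labelling i (suc j)
      ; irrefl = λ u → hidden-irrefl i (suc j) (toℕ u)
      ; symm   = λ u v → hidden-sym i (suc j) (toℕ u) (toℕ v)
      ; range  = λ u v x eq → label-range (hidden-edge {i} {suc j} {toℕ u} {toℕ v} eq)
      }
      where
      label-range : ∀ {a b x} → (OnCycleEdge i a b × x ≡ suc j) ⊎ (Background a b × x ≡ T) → 1 ≤ x × x ≤ T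
      label-range (inj₁ (_ , refl)) = s≤s z≤n , j<T
      label-range (inj₂ (_ , refl)) = 1≤T , ≤-refl

    SomeCandidate : (ℕ → ℕ → Set) → Set
    SomeCandidate P = ∃ λ i → i < n × ∃ λ j → j < T × P i j

    someCandidate? : ∀ {P : ℕ → ℕ → Set} → (∀ i j → Dec (P i j)) → Dec (SomeCandidate P)
    someCandidate? P? = anyUpTo? (λ i → anyUpTo? (P? i) T) n

    toCandidate : ∀ {P} → SomeCandidate P → Candidate
    toCandidate (i , i<n , j , j<T , _) = candidate i j i<n j<T

    -- A seed (x , s) makes x infectious at exactly the times suc j with s ≤ j < s + δ.
    RulesOut : Fin n × ℕ → ℕ → ℕ → Set
    RulesOut (x , s) i j = Endpoint i (toℕ x) × InInterval s δ j

    rulesOut? : ∀ sd i j → Dec (RulesOut sd i j)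
    rulesOut? (x , s) i j = endpoint? i (toℕ x) ×-dec inInterval? s δ j

    Possible : Seeds n → ℕ → ℕ → Set
    Possible L i j = All (λ sd → ¬ RulesOut sd i j) L

    possible? : ∀ L i j → Dec (Possible L i j)
    possible? L i j = all? (λ sd → ¬? (rulesOut? sd i j)) L

    horizon : Seeds n → ℕ
    horizon q = max T (map proj₂ q)

    logOn : Labelling n → Seeds n → InfLog n
    logOn l q = Simulation.logBefore δ l q (suc (horizon q))

    logOn-consistent : ∀ l q → (∀ u w t → l u w ≡ just t → t ≤ T) → ConsistentLog δ l q (logOn l q)
    logOn-consistent l q label≤T = Simulation.logBefore-consistent δ l q (horizon q)
      (λ u w t eq → ≤-trans (label≤T u w t eq) (⊥≤max T (map proj₂ q)))
      (λ u t u∈q → lookupᴬ (xs≤max T (map proj₂ q)) (∈-map⁺ proj₂ u∈q))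

    backgroundLabelling : Labelling n
    backgroundLabelling u v = background (toℕ u) (toℕ v)

    backgroundLog : Seeds n → InfLog n
    backgroundLog = logOn backgroundLabelling

    candidateLog : Candidate → Seeds n → InfLog n
    candidateLog c = logOn (lab (graph c))

    candidateLog-consistent : ∀ c q → ConsistentLog δ (lab (graph c)) q (candidateLog c q)
    candidateLog-consistent c q = logOn-consistent (lab (graph c)) q (λ u w t eq → proj₂ (range (graph c) u w t eq))

    -- Background edges infect only at time T, after the label suc j of the hidden edge, so the
    -- hidden edge of a possible candidate never transmits.
    backgroundLog-consistent : ∀ c q → Possible q (edge c) (slot c) → ConsistentLog δ (lab (graph c)) q (backgroundLog q)
    backgroundLog-consistent (candidate i j _ j<T) q possible =
      consistentLog-extend δ backgroundLabelling (labelling i (suc j)) q (backgroundLog q) consistent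
        (λ u w x eq → background⇒hidden eq) silent
      where
      consistent : ConsistentLog δ backgroundLabelling q (backgroundLog q)
      consistent = logOn-consistent backgroundLabelling q
        (λ u w t eq → ≤-reflexive (proj₂ (background-just (toℕ u) (toℕ w) eq)))
      endpoint : ∀ {a b} → OnCycleEdge i a b → Endpoint i b
      endpoint (inj₁ (_ , b≡hi)) = inj₂ b≡hi
      endpoint (inj₂ (b≡lo , _)) = inj₁ b≡lo
      silent : ∀ u w x → labelling i (suc j) u w ≡ just x →
        backgroundLabelling u w ≡ just x ⊎ ¬ Infectious δ (backgroundLog q) w x
      silent u w x eq with hidden⇒background eq
      ... | inj₁ bg               = inj₁ bg
      ... | inj₂ (onC , refl) = inj₂ λ (y , s , infected , s<t , t≤s+δ) → not-yet y s infected s<t t≤s+δ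
        where
        not-yet : ∀ y s → backgroundLog q w ≡ just (y , s) → s < suc j → suc j ≤ s + δ → ⊥
        not-yet y s infected s<t t≤s+δ with proj₁ (consistent w) y s infected
        ... | inj₁ (_ , w∈q)    = lookupᴬ possible w∈q (endpoint onC , ≤-pred s<t , t≤s+δ)
        ... | inj₂ (_ , bg , _) with refl ← proj₂ (background-just (toℕ w) (toℕ y) bg) =
          <-irrefl refl (≤-trans s<t j<T)

    seedsOf : History n → Seeds n
    seedsOf h = concat (map proj₁ h)

    Alive : Seeds n → Set
    Alive L = SomeCandidate (Possible L)

    alive? : ∀ L → Dec (Alive L)
    alive? L = someCandidate? (possible? L)

    candidateOr : ∀ {P} → Candidate → Dec (SomeCandidate P) → Candidate
    candidateOr _ (yes found) = toCandidate found
    candidateOr c (no _)      = c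

    -- The candidate that stayed possible longest: once every candidate is ruled out, the
    -- Adversary answers with the logs of its graph.
    fallback : History n → Candidate
    fallback []            = candidate 0 0 (s≤s z≤n) 1≤T
    fallback ((q , _) ∷ h) = candidateOr (fallback h) (alive? (q ++ seedsOf h))

    answerFor : ∀ {L} → Candidate → Seeds n → Dec (Alive L) → InfLog n
    answerFor _ q (yes _) = backgroundLog q
    answerFor c q (no _)  = candidateLog c q

    respond : History n → Seeds n → InfLog n
    respond h q = answerFor (fallback h) q (alive? (q ++ seedsOf h))

    Distinguishing : History n → Labelling n → ℕ → ℕ → Set
    Distinguishing h g i j = Possible (seedsOf h) i j × ¬ SameLabelling g (labelling i (suc j))

    distinguishing? : ∀ h g i j → Dec (Distinguishing h g i j)
    distinguishing? h g i j = possible? (seedsOf h) i j ×-dec ¬? (sameLabelling? g (labelling i (suc j)))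

    revealed : History n → Labelling n → Candidate
    revealed h g = candidateOr (fallback h) (someCandidate? (distinguishing? h g))

    adversary : Adversary n T
    adversary = record { answer = respond ; reveal = λ h g → graph (revealed h g) }

    ConsistentWith : Candidate → History n → Set
    ConsistentWith c h = All (λ r → ConsistentLog δ (lab (graph c)) (proj₁ r) (proj₂ r)) h

    record Invariant (f : Candidate) (h : History n) : Set where
      field
        possible-consistent : ∀ c → Possible (seedsOf h) (edge c) (slot c) → ConsistentWith c h
        fallback-consistent : ConsistentWith f h

    invariant : ∀ {k h} → Generated k adversary h → Invariant (fallback h) h
    invariant start = record { possible-consistent = λ _ _ → []ᴬ ; fallback-consistent = []ᴬ }
    invariant (step {h} q _ generated) = by (alive? (q ++ seedsOf h))
      where
      open Invariant (invariant generated)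
      quiet : ∀ c → Possible (q ++ seedsOf h) (edge c) (slot c) → ConsistentWith c ((q , backgroundLog q) ∷ h)
      quiet c p = backgroundLog-consistent c q (++⁻ˡ q p) ∷ possible-consistent c (++⁻ʳ q p)
      by : (d : Dec (Alive (q ++ seedsOf h))) →
        Invariant (candidateOr (fallback h) d) ((q , answerFor (fallback h) q d) ∷ h)
      by (yes alive@(_ , _ , _ , _ , p)) = record
        { possible-consistent = quiet
        ; fallback-consistent = quiet (toCandidate alive) p }
      by (no dead) = record
        { possible-consistent = λ c p → ⊥-elim (dead (edge c , edge<n c , slot c , slot<T c , p))
        ; fallback-consistent = candidateLog-consistent (fallback h) q ∷ fallback-consistent }

    revealed-consistent : ∀ {k} h g → Generated k adversary h → ConsistentWith (revealed h g) h
    revealed-consistent h g generated = by (someCandidate? (distinguishing? h g))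
      where
      by : (d : Dec (SomeCandidate (Distinguishing h g))) → ConsistentWith (candidateOr (fallback h) d) h
      by (yes found@(_ , _ , _ , _ , p , _)) = Invariant.possible-consistent (invariant generated) (toCandidate found) p
      by (no _)                              = Invariant.fallback-consistent (invariant generated)

    legal : ∀ k → LegalAdversary k δ (suc K) adversary
    legal k h generated g =
      edgeCount-labelling (edge c) (suc (slot c)) (edge<n c) (<⇒≤ K<filled) ,
      Connected.atMostTwoComponents δ (edge c) (suc (slot c)) K<filled ,
      revealed-consistent h g generated
      where
      c : Candidate
      c = revealed h g

    #possible : Seeds n → ℕ
    #possible L = ∑[ i < n ] ∑[ j < T ] 𝟙 (possible? L i j)

    rulesOut-count : ∀ sd → ∑[ i < n ] ∑[ j < T ] 𝟙 (rulesOut? sd i j) ≤ 2 * δ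
    rulesOut-count (x , s) = begin
      ∑[ i < n ] ∑[ j < T ] 𝟙 (rulesOut? (x , s) i j)
        ≡⟨ ∑-cong n (λ i _ → ∑-cong T (λ j _ → 𝟙-× (endpoint? i (toℕ x)) (inInterval? s δ j))) ⟩
      ∑[ i < n ] ∑[ j < T ] (𝟙 (endpoint? i (toℕ x)) * 𝟙 (inInterval? s δ j))
        ≡⟨ ∑∑-product n T (λ i → 𝟙 (endpoint? i (toℕ x))) (λ j → 𝟙 (inInterval? s δ j)) ⟩
      ∑[ i < n ] 𝟙 (endpoint? i (toℕ x)) * ∑[ j < T ] 𝟙 (inInterval? s δ j)
        ≤⟨ *-mono-≤ (endpoint-count (toℕ x)) (∑-interval≤ T s δ) ⟩
      2 * δ ∎
      where open ≤-Reasoning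

    #possible-bound : ∀ L → n * T ≤ #possible L + length L * (2 * δ)
    #possible-bound [] = ≤-reflexive (begin
      n * T                        ≡⟨ sym (∑-const n T) ⟩
      ∑[ _ < n ] T                 ≡⟨ ∑-cong n (λ _ _ → trans (sym (*-identityʳ T)) (sym (∑-const T 1))) ⟩
      ∑[ _ < n ] ∑[ _ < T ] 1      ≡⟨ sym (+-identityʳ _) ⟩
      #possible [] + 0             ∎)
      where open ≡-Reasoning
    #possible-bound (sd ∷ L) = begin
      n * T
        ≤⟨ #possible-bound L ⟩
      #possible L + length L * (2 * δ)
        ≤⟨ +-monoˡ-≤ _ (∑-mono-≤ n (λ i _ → ∑-mono-≤ T (λ j _ →
             𝟙-⊎ (possible? L i j) (possible? (sd ∷ L) i j) (rulesOut? sd i j) (survives i j)))) ⟩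
      ∑[ i < n ] ∑[ j < T ] (𝟙 (possible? (sd ∷ L) i j) + 𝟙 (rulesOut? sd i j)) + length L * (2 * δ)
        ≡⟨ cong (_+ length L * (2 * δ)) (trans (∑-cong n (λ i _ → ∑-+ T _ _)) (∑-+ n _ _)) ⟩
      #possible (sd ∷ L) + ∑[ i < n ] ∑[ j < T ] 𝟙 (rulesOut? sd i j) + length L * (2 * δ)
        ≤⟨ +-monoˡ-≤ _ (+-monoʳ-≤ (#possible (sd ∷ L)) (rulesOut-count sd)) ⟩
      #possible (sd ∷ L) + 2 * δ + length L * (2 * δ)
        ≡⟨ +-assoc (#possible (sd ∷ L)) (2 * δ) _ ⟩
      #possible (sd ∷ L) + length (sd ∷ L) * (2 * δ) ∎
      where
      open ≤-Reasoning
      survives : ∀ i j → Possible L i j → Possible (sd ∷ L) i j ⊎ RulesOut sd i j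
      survives i j p with rulesOut? sd i j
      ... | yes r = inj₂ r
      ... | no ¬r = inj₁ (¬r ∷ p)

    revealed-differs : ∀ h g → 2 ≤ #possible (seedsOf h) → ¬ SameLabelling g (lab (graph (revealed h g)))
    revealed-differs h g 2≤#possible = by (someCandidate? (distinguishing? h g))
      where
      by : (d : Dec (SomeCandidate (Distinguishing h g))) → ¬ SameLabelling g (lab (graph (candidateOr (fallback h) d)))
      by (yes (_ , _ , _ , _ , _ , differs)) = differs
      by (no none) = ⊥-elim (<⇒≱ 2≤#possible (∑∑-atMostOne n T (possible? (seedsOf h)) unique))
        where
        same : ∀ {i j} → i < n → j < T → Possible (seedsOf h) i j → SameLabelling g (labelling i (suc j))
        same {i} {j} i<n j<T p =
          decidable-stable (sameLabelling? g (labelling i (suc j))) (λ differs → none (i , i<n , j , j<T , p , differs))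
        unique : ∀ {i j i' j'} → i < n → j < T → i' < n → j' < T →
          Possible (seedsOf h) i j → Possible (seedsOf h) i' j' → i ≡ i' × j ≡ j'
        unique {i} {j} {i'} {j'} i<n j<T i'<n j'<T p p' = map₂ suc-injective
          (labelling-injective {i} {i'} {suc j} {suc j'} i<n
            (λ u v → trans (sym (same i<n j<T p u v)) (same i'<n j'<T p' u v)))

    seeds-length : ∀ {k h} → Generated k adversary h → length (seedsOf h) ≤ length h * k
    seeds-length start                    = z≤n
    seeds-length (step q |q|≤k generated) =
      ≤-trans (≤-reflexive (length-++ q)) (+-mono-≤ |q|≤k (seeds-length generated))

    many-possible : ∀ {k h} r → 1 ≤ δ → 1 ≤ k → suc r * (2 * δ * k) ≤ n * T →
      Generated k adversary h → length h ≤ r → 2 ≤ #possible (seedsOf h)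
    many-possible {k} {h} r 1≤δ 1≤k budget generated |h|≤r =
      ≤-trans 2≤cost (+-cancelʳ-≤ (r * cost) cost (#possible L) (begin
        suc r * cost                       ≤⟨ budget ⟩
        n * T                              ≤⟨ #possible-bound L ⟩
        #possible L + length L * (2 * δ)   ≤⟨ +-monoʳ-≤ (#possible L) seeds-cost ⟩
        #possible L + r * cost             ∎))
      where
      open ≤-Reasoning
      cost : ℕ
      cost = 2 * δ * k
      L : Seeds n
      L = seedsOf h
      2≤cost : 2 ≤ cost
      2≤cost = *-mono-≤ (*-monoʳ-≤ 2 1≤δ) 1≤k
      seeds-cost : length L * (2 * δ) ≤ r * cost
      seeds-cost = begin
        length L * (2 * δ) ≤⟨ *-monoˡ-≤ (2 * δ) (≤-trans (seeds-length generated) (*-monoˡ-≤ k |h|≤r)) ⟩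
        r * k * (2 * δ)    ≡⟨ rearrange r k δ ⟩
        r * cost           ∎
        where
        rearrange : ∀ r k δ → r * k * (2 * δ) ≡ r * (2 * δ * k)
        rearrange = solve-∀

    never-wins : ∀ {k} (D : Discoverer n k) r → 1 ≤ δ → 1 ≤ k → suc r * (2 * δ * k) ≤ n * T →
      ¬ WinsWithin D adversary r
    never-wins {k} D r 1≤δ 1≤k budget = loses r [] (D []) start ≤-refl
      where
      loses : ∀ r' h mv → Generated k adversary h → length h + r' ≤ r → ¬ winsFrom D adversary r' h mv
      loses r' h (guess g) generated used =
        revealed-differs h g (many-possible r 1≤δ 1≤k budget generated (≤-trans (m≤m+n (length h) r') used))
      loses zero     h (query q _)    _         _    = λ ()
      loses (suc r') h (query q |q|≤k) generated used =
        loses r' _ (D _) (step q |q|≤k generated) (≤-trans (≤-reflexive (sym (+-suc (length h) r'))) used)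

at-least-four : ∀ n m → 1 ≤ m → m ≤ (n C 2) ∸ n → ∃ λ n' → n ≡ 4 + n'
at-least-four 0 m 1≤m m≤ = ⊥-elim (1+n≰n (≤-trans 1≤m m≤))
at-least-four 1 m 1≤m m≤ = ⊥-elim (1+n≰n (≤-trans 1≤m m≤))
at-least-four 2 m 1≤m m≤ = ⊥-elim (1+n≰n (≤-trans 1≤m m≤))
at-least-four 3 m 1≤m m≤ = ⊥-elim (1+n≰n (≤-trans 1≤m m≤))
at-least-four (suc (suc (suc (suc n')))) _ _ _ = n' , refl

theorem11 : ∀ (n T k m δ : ℕ) → 1 ≤ n → 1 ≤ T → 1 ≤ k → k ≤ n →
    1 ≤ m → m ≤ (n C 2) ∸ n → 1 ≤ δ → δ ≤ T →
    Σ (Adversary n T) λ A → LegalAdversary k δ m A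
      × (∀ (D : Discoverer n k) (r : ℕ) → WinsWithin D A r → roundBound n T δ k ≤ r)
theorem11 _ _ zero _       _       _ _   ()  _ _ _ _  _
theorem11 _ _ _    zero    _       _ _   _   _ () _ _ _
theorem11 _ _ _    _       zero    _ _   _   _ _ _ () _
theorem11 n T (suc k) (suc K) (suc d) _ 1≤T _ _ 1≤m m≤ _ _ with at-least-four n (suc K) 1≤m m≤
... | n' , refl = adversary , legal (suc k) , lower-bound
  where
  open HiddenCycleEdge n' K T using (filledBefore; filledBefore-n; module Strategy)
  K<filled : K < filledBefore n
  K<filled = subst (suc K ≤_) (sym filledBefore-n) m≤
  open Strategy (suc d) 1≤T K<filled
  lower-bound : ∀ D r → WinsWithin D adversary r → roundBound n T (suc d) (suc k) ≤ r
  lower-bound D r wins = decidable-stable (roundBound n T (suc d) (suc k) ≤? r)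
    (λ too-few → never-wins D r (s≤s z≤n) (s≤s z≤n) (quotient-exceeded (n * T) _ r too-few) wins)
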